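{- Let $\Omega\in\mathcal{M}_{n,1}$ with dual $\overline{\Omega}\in\mathcal{M}_{n,1}$, and let $(k;a_1,\dots,a_n;b,\beta)$ and $(k;\overline{a}_1,\dots,\overline{a}_n;\overline{b},\overline{\beta})$ be the generalized inversion tables of $\Phi^{ -1}(\Omega)$ and $\Phi^{ -1}(\overline{\Omega})$ respectively. Then $$\overline{a}_i=i-1-a_i\ (i\ne k-1),\qquad \overline{a}_{k-1}=k-2-a_k-b,\qquad \overline{b}=a_k-1-a_{k-1},\qquad \overline{\beta}=a_k+b-a_{k-1}-\beta-1.$$
   Context: Mixed configurations: $\mathcal{G}_n=\{(x,y)\in\mathbb{Z}^2: 0\le x<y\le n\}$. Steps: $E$ and $F$ both go $(x,y)\to(x+1,y)$ but are different kinds of steps; $S$: $(x,y)\to(x,y-1)$; $N$: $(x,y)\to(x+1,y+1)$. A mixed path is a lattice path in $\mathcal{G}_n$ whose step word is $uv$ with $u$ a word over $\{S,E\}$ (Left part) and $v$ a word over $\{F,N\}$ (Right part); the vertex reached after $u$ is the junction. An order-$n$ mixed configuration is a sequence $\Omega=(\omega_1,\dots,\omega_n)$ of mixed paths such that for a permutation $\sigma$ of $\{1,\dots,n\}$, $\omega_i$ goes from $(0,i)$ to $(\sigma(i)-1,\sigma(i))$, no two Left parts share a vertex and no two Right parts share a vertex. $\mathcal{M}_{n,1}$ is the set of those with exactly one $N$-step in total. Generalized inversion tables and $\Phi$: the map $\Phi$ is a bijection from $\mathcal{N}_{n,1}$ onto $\mathcal{M}_{n,1}$, and the set of generalized inversion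 tables of elements of $\mathcal{N}_{n,1}$ is exactly the set of sequences $(k;a_1,\dots,a_n;b,\beta)$ of non-negative integers with $3\le k\le n$, $a_i\le i-1$, $a_{k-1}<a_k$, $a_{k-1}+\beta<a_k+b\le k-2$. In terms of these tables, $\Phi$ sends the element with table $(k;a_1,\dots,a_n;b,\beta)$ to $(\omega_1,\dots,\omega_n)$ with $\omega_i=E^{a_i}F^{i-1-a_i}$ for $i\ne k-1,k$, $\omega_{k-1}=E^{a_{k-1}}F^{\beta}NF^{k-2-a_{k-1}-\beta}$, $\omega_k=E^{a_k}SE^{b}F^{k-2-a_k-b}$. So each $\Omega\in\mathcal{M}_{n,1}$ "encodes" a unique such table, the table of $\Phi^{ -1}(\Omega)$. (Here, for $(N,E)$ with $N$ a neutral order-$n$ alternating sign matrix with one $-1$ whose opening row is row $n+1-k$: $a_i$ is the sum of entries of $N$ strictly below row $n+1-i$ and left of the unique (leftmost if $i=k-1$) $1$ of that row, $b=c(N)$, $\beta=E+\ell(N)$.) Duality: let $\rho(x,y)=(y-1-x,y)$. For $\Omega\in\mathcal{M}_{n,1}$, its dual $\overline{\Omega}\in\mathcal{M}_{n,1}$ is the mixed configuration (obtained by Gessel–Viennot path duality applied separately to the Left parts and the Right parts, followed by reflection) characterized by: a vertex $v$ is a junction of $\Omega$ iff $\rho(v)$ is a junction of $\overline{\Omega}$; $v$ is the starting vertex of an $S$-step of $\Omega$ iff $\rho(v)$ is the starting vertex of an $S$-step of $\overline{\Omega}$; $v$ is the ending vertex of an $N$-step of $\Omega$ iff $\rho(v)$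 is the ending vertex of an $N$-step of $\overline{\Omega}$. -}

module Defs where

open import Data.Nat using (ℕ; zero; suc; _+_; _∸_; _≤_; _<_)
open import Data.Nat.Properties using (_≟_)
open import Data.Fin using (Fin; toℕ)
import Data.Fin as Fin
import Data.Product
open import Data.Fin.Permutation using (Permutation′; _⟨$⟩ʳ_)
open import Data.List using (List; []; _∷_; _++_; scanl; foldl; map; allFin; replicate; length; filterᵇ)
open import Data.List.Membership.Propositional using (_∈_; _∉_)
open import Data.List.Relation.Unary.All using (All)
open import Data.Product using (_×_; _,_; Σ; ∃; ∃-syntax)
open import Data.Nat.ListAction using (sum)
open import Relation.Nullary using (¬_; yes; no)
open import Relation.Binary.PropositionalEquality using (_≡_; _≢_)
open import Function.Bundles using (_⇔_)

Point : Set
Point = ℕ × ℕ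

InG : ℕ → Point → Set
InG n (x , y) = (x < y) × (y ≤ n)

data LStep : Set where
  S E : LStep

data RStep : Set where
  F N : RStep

stepL : Point → LStep → Point
stepL (x , y) S = (x , y ∸ 1)
stepL (x , y) E = (suc x , y)

stepR : Point → RStep → Point
stepR (x , y) F = (suc x , y)
stepR (x , y) N = (suc x , suc y)

MixedPath : Set
MixedPath = List LStep × List RStep

-- An order-n configuration: ω_i for i = 1..n is  ω (i-1)  with index in Fin n.
Config : ℕ → Set
Config n = Fin n → MixedPath

start : ∀ {n} → Fin n → Point
start j = (0 , suc (toℕ j))

leftVerts : Point → MixedPath → List Point
leftVerts p (u , v) = scanl stepL p u

junction : Point → MixedPath → Point
junction p (u , v) = foldl stepL p u

rightVerts : Point → MixedPath → List Point
rightVerts p (u , v) = scanl stepR (junction p (u , v)) v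

endpoint : Point → MixedPath → Point
endpoint p (u , v) = foldl stepR (junction p (u , v)) v

sStarts : Point → List LStep → List Point
sStarts p []      = []
sStarts p (S ∷ u) = p ∷ sStarts (stepL p S) u
sStarts p (E ∷ u) = sStarts (stepL p E) u

nEnds : Point → List RStep → List Point
nEnds p []      = []
nEnds p (N ∷ v) = stepR p N ∷ nEnds (stepR p N) v
nEnds p (F ∷ v) = nEnds (stepR p F) v

IsMixedConfig : (n : ℕ) → Config n → Set
IsMixedConfig n ω =
  (∀ j → All (InG n) (leftVerts (start j) (ω j)) × All (InG n) (rightVerts (start j) (ω j)))
  × (Σ (Permutation′ n) λ σ → ∀ j →
        endpoint (start j) (ω j) ≡ (toℕ (σ ⟨$⟩ʳ j) , suc (toℕ (σ ⟨$⟩ʳ j))))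
  × (∀ j j' → j ≢ j' → ∀ p → p ∈ leftVerts (start j) (ω j) → p ∉ leftVerts (start j') (ω j'))
  × (∀ j j' → j ≢ j' → ∀ p → p ∈ rightVerts (start j) (ω j) → p ∉ rightVerts (start j') (ω j'))

countN : List RStep → ℕ
countN []      = 0
countN (N ∷ v) = suc (countN v)
countN (F ∷ v) = countN v

totalN : ∀ {n} → Config n → ℕ
totalN {n} ω = sum (map (λ j → countN (Data.Product.proj₂ (ω j))) (allFin n))

InM1 : (n : ℕ) → Config n → Set
InM1 n ω = IsMixedConfig n ω × (totalN ω ≡ 1)

ρ : Point → Point
ρ (x , y) = (y ∸ suc x , y)

IsJunction : ∀ {n} → Config n → Point → Set
IsJunction ω p = ∃[ j ] junction (start j) (ω j) ≡ p

IsSStart : ∀ {n} → Config n → Point → Set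
IsSStart ω p = ∃[ j ] p ∈ sStarts (start j) (Data.Product.proj₁ (ω j))

IsNEnd : ∀ {n} → Config n → Point → Set
IsNEnd ω p = ∃[ j ] p ∈ nEnds (junction (start j) (ω j)) (Data.Product.proj₂ (ω j))

-- Ωbar is the dual of Ω (both assumed in M_{n,1})
IsDual : (n : ℕ) → Config n → Config n → Set
IsDual n ω ωb = ∀ p → InG n p →
    (IsJunction ω p ⇔ IsJunction ωb (ρ p))
  × (IsSStart ω p ⇔ IsSStart ωb (ρ p))
  × (IsNEnd ω p ⇔ IsNEnd ωb (ρ p))

record Table (n : ℕ) : Set where
  constructor table
  field
    k : ℕ
    a : Fin n → ℕ      -- a_i = a (i-1)
    b : ℕ
    β : ℕ

-- 1-based access: at a i = a_i for 1 ≤ i ≤ n (0 otherwise)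
at : ∀ {n} → (Fin n → ℕ) → ℕ → ℕ
at {zero}  a m             = 0
at {suc n} a zero          = 0
at {suc n} a (suc zero)    = a Fin.zero
at {suc n} a (suc (suc m)) = at (λ j → a (Fin.suc j)) (suc m)

ValidTable : (n : ℕ) → Table n → Set
ValidTable n (table k a b β) =
    (3 ≤ k) × (k ≤ n)
  × (∀ j → a j ≤ toℕ j)
  × (at a (k ∸ 1) < at a k)
  × (at a (k ∸ 1) + β < at a k + b)
  × (at a k + b ≤ k ∸ 2)

Es : ℕ → List LStep
Es m = replicate m E

Fs : ℕ → List RStep
Fs m = replicate m F

Φ : ∀ {n} → Table n → Config n
Φ (table k a b β) j with suc (toℕ j) ≟ k ∸ 1 | suc (toℕ j) ≟ k
... | yes _ | _     = (Es (a j) , Fs β ++ N ∷ Fs (k ∸ 2 ∸ a j ∸ β))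
... | no _  | yes _ = (Es (a j) ++ S ∷ Es b , Fs (k ∸ 2 ∸ a j ∸ b))
... | no _  | no _  = (Es (a j) , Fs (toℕ j ∸ a j))

-- Under Φ every feature of a mixed configuration lies at a point read off its table: the S-step
-- starts at (a_k, k), row i ≠ k has its junction at (a_i, i), row k at (a_k + b, k − 1), and the
-- N-step ends at (a_{k−1} + β + 1, k).  Duality carries these features through
-- ρ(x, y) = (y − 1 − x, y) onto the features of the dual, which are read off its table the same
-- way.  The S-step gives k̄ = k and ā_k; every row i ∉ {k − 1, k} holds a single junction, giving
-- ā_i; row k − 1 holds two junctions, and as ρ reverses the order within a row, the smaller of
-- ā_{k−1} and ā_k + b̄ is the image of a_k + b, giving ā_{k−1} and b̄; the N-step then gives β̄.
module Submission where

open import Defs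
open import Data.Nat using (ℕ; zero; suc; _+_; _∸_; _≤_; _<_; s≤s)
open import Data.Nat.Properties
  using (_≟_; 1+n≢n; <-irrefl; <-asym; ≤-trans; <⇒≤; n≤1+n; m≤n⇒m≤1+n; m≤m+n; ≤-<-trans;
         <-≤-trans; m+n≤o⇒m≤o; +-identityʳ; +-suc; +-cancelˡ-≡; ∸-+-assoc; +-∸-assoc; m∸n+n≡m; suc-injective;
         ∸-monoʳ-<)
open import Data.Fin using (Fin; toℕ; fromℕ<)
import Data.Fin as Fin
open import Data.Fin.Properties using (toℕ<n; toℕ-fromℕ<)
open import Data.List using ([]; _∷_; _++_; foldl)
open import Data.List.Properties using (foldl-++)
open import Data.List.Membership.Propositional using (_∈_)
open import Data.List.Relation.Unary.Any using (here)
open import Data.List.Relation.Unary.Any.Properties using (singleton⁻)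
open import Data.Product using (_×_; _,_; proj₁; proj₂; ∃-syntax; map₂)
open import Data.Product.Properties using (,-injective; ,-injectiveˡ)
open import Data.Sum using (_⊎_; inj₁; inj₂)
import Data.Sum as Sum
open import Relation.Nullary using (yes; no; contradiction)
open import Relation.Binary.PropositionalEquality
open ≡-Reasoning
open import Function using (_∘_)
open import Function.Bundles using (_⇔_; mk⇔; Equivalence)
open import Function.Construct.Composition using (_⇔-∘_)

at-suc-toℕ : ∀ {n} (a : Fin n → ℕ) (j : Fin n) → at a (suc (toℕ j)) ≡ a j
at-suc-toℕ a Fin.zero    = refl
at-suc-toℕ a (Fin.suc j) = at-suc-toℕ (a ∘ Fin.suc) j

1+m≡n∸1⇒1+m≢n : ∀ {m n} → suc m ≡ n ∸ 1 → suc m ≢ n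
1+m≡n∸1⇒1+m≢n 1+m≡n∸1 1+m≡n = 1+n≢n (trans 1+m≡n∸1 (cong (_∸ 1) (sym 1+m≡n)))

[m∸n]+o≡m∸p⇒o≡n∸p : ∀ {m n o p} → p ≤ n → n ≤ m → (m ∸ n) + o ≡ m ∸ p → o ≡ n ∸ p
[m∸n]+o≡m∸p⇒o≡n∸p {m} {n} {o} {p} p≤n n≤m eq = +-cancelˡ-≡ (m ∸ n) o (n ∸ p) (begin
  (m ∸ n) + o        ≡⟨ eq ⟩
  m ∸ p              ≡⟨ cong (_∸ p) (sym (m∸n+n≡m n≤m)) ⟩
  (m ∸ n) + n ∸ p    ≡⟨ +-∸-assoc (m ∸ n) p≤n ⟩
  (m ∸ n) + (n ∸ p)  ∎)

ordered-pairs-match : ∀ {u v x y : ℕ} → u < v → x < y →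
  u ≡ x ⊎ u ≡ y → v ≡ x ⊎ v ≡ y → u ≡ x × v ≡ y
ordered-pairs-match u<v x<y (inj₁ u≡x)  (inj₂ v≡y)  = u≡x , v≡y
ordered-pairs-match u<v x<y (inj₁ refl) (inj₁ refl) = contradiction u<v (<-irrefl refl)
ordered-pairs-match u<v x<y (inj₂ refl) (inj₂ refl) = contradiction u<v (<-irrefl refl)
ordered-pairs-match u<v x<y (inj₂ refl) (inj₁ refl) = contradiction x<y (<-asym u<v)

foldl-Es : ∀ m {x y} → foldl stepL (x , y) (Es m) ≡ (x + m , y)
foldl-Es zero    {x} = cong (_, _) (sym (+-identityʳ x))
foldl-Es (suc m) {x} {y} = trans (foldl-Es m) (cong (_, y) (sym (+-suc x m)))

sStarts-Es : ∀ m {p} → sStarts p (Es m) ≡ []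
sStarts-Es zero    = refl
sStarts-Es (suc m) = sStarts-Es m

sStarts-Es-++ : ∀ m {x y} u → sStarts (x , y) (Es m ++ u) ≡ sStarts (x + m , y) u
sStarts-Es-++ zero    {x} u = cong (λ z → sStarts (z , _) u) (sym (+-identityʳ x))
sStarts-Es-++ (suc m) {x} {y} u = trans (sStarts-Es-++ m u) (cong (λ z → sStarts (z , y) u) (sym (+-suc x m)))

nEnds-Fs : ∀ m {p} → nEnds p (Fs m) ≡ []
nEnds-Fs zero    = refl
nEnds-Fs (suc m) = nEnds-Fs m

nEnds-Fs-++ : ∀ m {x y} v → nEnds (x , y) (Fs m ++ v) ≡ nEnds (x + m , y) v
nEnds-Fs-++ zero    {x} v = cong (λ z → nEnds (z , _) v) (sym (+-identityʳ x))
nEnds-Fs-++ (suc m) {x} {y} v = trans (nEnds-Fs-++ m v) (cong (λ z → nEnds (z , y) v) (sym (+-suc x m)))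

module Row {n k : ℕ} {a : Fin n → ℕ} {b β : ℕ} (j : Fin n) where

  Φ-left-≢ : suc (toℕ j) ≢ k → proj₁ (Φ (table k a b β) j) ≡ Es (a j)
  Φ-left-≢ ≢k with suc (toℕ j) ≟ k ∸ 1 | suc (toℕ j) ≟ k
  ... | yes _ | _      = refl
  ... | no _  | yes ≡k = contradiction ≡k ≢k
  ... | no _  | no _   = refl

  Φ-left-≡ : suc (toℕ j) ≡ k → proj₁ (Φ (table k a b β) j) ≡ Es (a j) ++ S ∷ Es b
  Φ-left-≡ ≡k with suc (toℕ j) ≟ k ∸ 1 | suc (toℕ j) ≟ k
  ... | yes ≡k-1 | _     = contradiction ≡k (1+m≡n∸1⇒1+m≢n ≡k-1)
  ... | no _     | yes _ = refl
  ... | no _     | no ≢k = contradiction ≡k ≢k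

  Φ-right-≢ : suc (toℕ j) ≢ k ∸ 1 → ∃[ m ] proj₂ (Φ (table k a b β) j) ≡ Fs m
  Φ-right-≢ ≢k-1 with suc (toℕ j) ≟ k ∸ 1 | suc (toℕ j) ≟ k
  ... | yes ≡k-1 | _     = contradiction ≡k-1 ≢k-1
  ... | no _     | yes _ = _ , refl
  ... | no _     | no _  = _ , refl

  Φ-right-≡ : suc (toℕ j) ≡ k ∸ 1 → ∃[ m ] proj₂ (Φ (table k a b β) j) ≡ Fs β ++ N ∷ Fs m
  Φ-right-≡ ≡k-1 with suc (toℕ j) ≟ k ∸ 1
  ... | yes _     = _ , refl
  ... | no ≢k-1   = contradiction ≡k-1 ≢k-1

  junction-Φ-≢ : suc (toℕ j) ≢ k → junction (start j) (Φ (table k a b β) j) ≡ (a j , suc (toℕ j))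
  junction-Φ-≢ ≢k = trans (cong (foldl stepL (start j)) (Φ-left-≢ ≢k)) (foldl-Es (a j))

  junction-Φ-≡ : suc (toℕ j) ≡ k → junction (start j) (Φ (table k a b β) j) ≡ (a j + b , toℕ j)
  junction-Φ-≡ ≡k = begin
    foldl stepL (start j) (proj₁ (Φ (table k a b β) j))        ≡⟨ cong (foldl stepL (start j)) (Φ-left-≡ ≡k) ⟩
    foldl stepL (start j) (Es (a j) ++ S ∷ Es b)                ≡⟨ foldl-++ stepL (start j) (Es (a j)) (S ∷ Es b) ⟩
    foldl stepL (foldl stepL (start j) (Es (a j))) (S ∷ Es b)   ≡⟨ cong (λ p → foldl stepL p (S ∷ Es b)) (foldl-Es (a j)) ⟩
    foldl stepL (a j , toℕ j) (Es b)                            ≡⟨ foldl-Es b ⟩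
    (a j + b , toℕ j)                                           ∎

  sStarts-Φ-≢ : suc (toℕ j) ≢ k → sStarts (start j) (proj₁ (Φ (table k a b β) j)) ≡ []
  sStarts-Φ-≢ ≢k = trans (cong (sStarts (start j)) (Φ-left-≢ ≢k)) (sStarts-Es (a j))

  sStarts-Φ-≡ : suc (toℕ j) ≡ k → sStarts (start j) (proj₁ (Φ (table k a b β) j)) ≡ (a j , suc (toℕ j)) ∷ []
  sStarts-Φ-≡ ≡k = begin
    sStarts (start j) (proj₁ (Φ (table k a b β) j))  ≡⟨ cong (sStarts (start j)) (Φ-left-≡ ≡k) ⟩
    sStarts (start j) (Es (a j) ++ S ∷ Es b)          ≡⟨ sStarts-Es-++ (a j) (S ∷ Es b) ⟩
    (a j , suc (toℕ j)) ∷ sStarts (a j , toℕ j) (Es b) ≡⟨ cong (_ ∷_) (sStarts-Es b) ⟩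
    (a j , suc (toℕ j)) ∷ []                          ∎

  nEnds-Φ-≢ : suc (toℕ j) ≢ k ∸ 1 →
    nEnds (junction (start j) (Φ (table k a b β) j)) (proj₂ (Φ (table k a b β) j)) ≡ []
  nEnds-Φ-≢ ≢k-1 = let m , eq = Φ-right-≢ ≢k-1 in trans (cong (nEnds _) eq) (nEnds-Fs m)

  nEnds-Φ-≡ : suc (toℕ j) ≡ k ∸ 1 →
    nEnds (junction (start j) (Φ (table k a b β) j)) (proj₂ (Φ (table k a b β) j))
      ≡ (suc (a j + β) , suc (suc (toℕ j))) ∷ []
  nEnds-Φ-≡ ≡k-1 = let m , eq = Φ-right-≡ ≡k-1 in begin
    nEnds (junction (start j) (Φ (table k a b β) j)) (proj₂ (Φ (table k a b β) j))
      ≡⟨ cong₂ nEnds (junction-Φ-≢ (1+m≡n∸1⇒1+m≢n ≡k-1)) eq ⟩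
    nEnds (a j , suc (toℕ j)) (Fs β ++ N ∷ Fs m)
      ≡⟨ nEnds-Fs-++ β (N ∷ Fs m) ⟩
    (suc (a j + β) , suc (suc (toℕ j))) ∷ nEnds _ (Fs m)
      ≡⟨ cong (_ ∷_) (nEnds-Fs m) ⟩
    (suc (a j + β) , suc (suc (toℕ j))) ∷ []
      ∎

module Features {n} {a : Fin n → ℕ} {b β : ℕ} where

  open module Rowₖ {k} = Row {n} {k} {a} {b} {β}

  sStart-Φ : ∀ {r} → r < n → IsSStart (Φ (table (suc r) a b β)) (at a (suc r) , suc r)
  sStart-Φ r<n with fromℕ< r<n | toℕ-fromℕ< r<n
  ... | j | refl = j , subst (_ ∈_) (sym (sStarts-Φ-≡ j refl)) (here (cong (_, _) (at-suc-toℕ a j)))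

  junction-Φ : ∀ {k r} → r < n → suc r ≢ k → IsJunction (Φ (table k a b β)) (at a (suc r) , suc r)
  junction-Φ r<n ≢k with fromℕ< r<n | toℕ-fromℕ< r<n
  ... | j | refl = j , trans (junction-Φ-≢ j ≢k) (cong (_, _) (sym (at-suc-toℕ a j)))

  junction-Φ-last : ∀ {r} → r < n → IsJunction (Φ (table (suc r) a b β)) (at a (suc r) + b , r)
  junction-Φ-last r<n with fromℕ< r<n | toℕ-fromℕ< r<n
  ... | j | refl = j , trans (junction-Φ-≡ j refl) (cong (λ z → (z + b , _)) (sym (at-suc-toℕ a j)))

  nEnd-Φ : ∀ {r} → r < n →
    IsNEnd (Φ (table (suc (suc r)) a b β)) (suc (at a (suc r) + β) , suc (suc r))
  nEnd-Φ r<n with fromℕ< r<n | toℕ-fromℕ< r<n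
  ... | j | refl = j , subst (_ ∈_) (sym (nEnds-Φ-≡ {suc (suc (toℕ j))} j refl))
                            (here (cong (λ z → (suc (z + β) , suc (suc (toℕ j)))) (at-suc-toℕ a j)))

  -- The case splits test k ≟ suc (toℕ j), not the comparison Φ itself makes, so that `with`
  -- leaves the types of the hypotheses about Φ untouched.
  sStart-Φ⁻¹ : ∀ {k p} → IsSStart (Φ (table k a b β)) p → p ≡ (at a k , k)
  sStart-Φ⁻¹ {k} (j , p∈) with k ≟ suc (toℕ j)
  ... | no ≢k    = contradiction (subst (_ ∈_) (sStarts-Φ-≢ j (≢k ∘ sym)) p∈) λ ()
  ... | yes refl = trans (singleton⁻ (subst (_ ∈_) (sStarts-Φ-≡ j refl) p∈))
                         (cong (_, _) (sym (at-suc-toℕ a j)))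

  junction-Φ⁻¹ : ∀ {k x y} → IsJunction (Φ (table k a b β)) (x , y) →
    x ≡ at a y ⊎ (y ≡ k ∸ 1 × x ≡ at a k + b)
  junction-Φ⁻¹ {k} (j , eq) with k ≟ suc (toℕ j)
  ... | no ≢k with trans (sym (junction-Φ-≢ j (≢k ∘ sym))) eq
  ...   | refl = inj₁ (sym (at-suc-toℕ a j))
  junction-Φ⁻¹ {k} (j , eq) | yes refl with trans (sym (junction-Φ-≡ j refl)) eq
  ...   | refl = inj₂ (refl , cong (_+ b) (sym (at-suc-toℕ a j)))

  nEnd-Φ⁻¹ : ∀ {r p} → IsNEnd (Φ (table (suc (suc r)) a b β)) p →
    p ≡ (suc (at a (suc r) + β) , suc (suc r))
  nEnd-Φ⁻¹ {r} (j , p∈) with r ≟ toℕ j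
  ... | no r≢j    = contradiction (subst (_ ∈_) (nEnds-Φ-≢ {suc (suc r)} j (r≢j ∘ sym ∘ suc-injective)) p∈) λ ()
  ... | yes refl = trans (singleton⁻ (subst (_ ∈_) (nEnds-Φ-≡ {suc (suc (toℕ j))} j refl) p∈))
                         (cong (λ z → (suc (z + β) , suc (suc (toℕ j)))) (sym (at-suc-toℕ a j)))

∃-resp : ∀ {n} {ω ω′ : Config n} (Q : Fin n → MixedPath → Set) → ω ≗ ω′ →
  (∃[ j ] Q j (ω j)) ⇔ (∃[ j ] Q j (ω′ j))
∃-resp Q ω≗ω′ = mk⇔ (map₂ (λ {j} → subst (Q j) (ω≗ω′ j))) (map₂ (λ {j} → subst (Q j) (sym (ω≗ω′ j))))

IsDual-resp : ∀ {n} {ω ω′ ωb ωb′ : Config n} → ω ≗ ω′ → ωb ≗ ωb′ → IsDual n ω′ ωb′ → IsDual n ω ωb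
IsDual-resp {n} {ω} {ω′} {ωb} {ωb′} ω≗ω′ ωb≗ωb′ dual p p∈G =
  let isJ , isS , isN = dual p p∈G in
    transport (λ j w → junction (start j) w ≡ p) (λ j w → junction (start j) w ≡ ρ p) isJ
  , transport (λ j w → p ∈ sStarts (start j) (proj₁ w)) (λ j w → ρ p ∈ sStarts (start j) (proj₁ w)) isS
  , transport (λ j w → p ∈ nEnds (junction (start j) w) (proj₂ w))
              (λ j w → ρ p ∈ nEnds (junction (start j) w) (proj₂ w)) isN
  where
  transport : (Q Qb : Fin n → MixedPath → Set) →
    (∃[ j ] Q j (ω′ j)) ⇔ (∃[ j ] Qb j (ωb′ j)) → (∃[ j ] Q j (ω j)) ⇔ (∃[ j ] Qb j (ωb j))
  transport Q Qb Q⇔Qb = ∃-resp Qb (sym ∘ ωb≗ωb′) ⇔-∘ (Q⇔Qb ⇔-∘ ∃-resp Q ω≗ω′)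

-- Stated for an instance `dual p p∈G` rather than for IsDual, since the configurations of an
-- IsDual hypothesis cannot be inferred once it unfolds.
module _ {J J′ S S′ N N′ : Set} (dual-at : (J ⇔ J′) × (S ⇔ S′) × (N ⇔ N′)) where

  junction-ρ : J → J′
  junction-ρ = Equivalence.to (proj₁ dual-at)

  sStart-ρ : S → S′
  sStart-ρ = Equivalence.to (proj₁ (proj₂ dual-at))

  nEnd-ρ : N → N′
  nEnd-ρ = Equivalence.to (proj₂ (proj₂ dual-at))

module _ {n} {a ab : Fin n → ℕ} {b β bb βb : ℕ} where

  private
    module F  = Features {a = a}  {b}  {β}
    module Fb = Features {a = ab} {bb} {βb}

  dual-last-row : ∀ {r kb} → IsDual n (Φ (table (suc r) a b β)) (Φ (table kb ab bb βb)) →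
    at a (suc r) ≤ r → r < n → kb ≡ suc r × at ab kb ≡ r ∸ at a (suc r)
  dual-last-row {r} dual a≤r r<n =
    let x≡ , k≡ = ,-injective (Fb.sStart-Φ⁻¹ (sStart-ρ (dual _ (s≤s a≤r , r<n)) (F.sStart-Φ r<n)))
    in sym k≡ , sym x≡

  dual-entry : ∀ {k r} → IsDual n (Φ (table k a b β)) (Φ (table k ab bb βb)) →
    at a (suc r) ≤ r → r < n → suc r ≢ k ∸ 1 → at ab (suc r) ≡ r ∸ at a (suc r)
  dual-entry {k} {r} dual a≤r r<n ≢k-1 with k ≟ suc r
  ... | yes refl = proj₂ (dual-last-row {r} {suc r} dual a≤r r<n)
  ... | no ≢k with Fb.junction-Φ⁻¹ {k} (junction-ρ (dual _ (s≤s a≤r , r<n)) (F.junction-Φ {k} r<n (≢k ∘ sym)))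
  ...   | inj₁ x≡        = sym x≡
  ...   | inj₂ (≡k-1 , _) = contradiction ≡k-1 ≢k-1

  dual-entries : ∀ {k} → IsDual n (Φ (table k a b β)) (Φ (table k ab bb βb)) →
    (∀ j → a j ≤ toℕ j) → ∀ j → suc (toℕ j) ≢ k ∸ 1 → ab j ≡ toℕ j ∸ a j
  dual-entries {k} dual a≤ j ≢k-1 = begin
    ab j                        ≡⟨ sym (at-suc-toℕ ab j) ⟩
    at ab (suc (toℕ j))         ≡⟨ dual-entry {k} dual (subst (_≤ toℕ j) (sym (at-suc-toℕ a j)) (a≤ j)) (toℕ<n j) ≢k-1 ⟩
    toℕ j ∸ at a (suc (toℕ j))  ≡⟨ cong (toℕ j ∸_) (at-suc-toℕ a j) ⟩
    toℕ j ∸ a j                 ∎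

  dual-penult-row : ∀ {K} →
    IsDual n (Φ (table (suc (suc K)) a b β)) (Φ (table (suc (suc K)) ab bb βb)) →
    ValidTable n (table (suc (suc K)) a b β) → ValidTable n (table (suc (suc K)) ab bb βb) →
    K ∸ (at a (suc (suc K)) + b) ≡ at ab (suc K) × K ∸ at a (suc K) ≡ at ab (suc (suc K)) + bb
  dual-penult-row {K} dual (_ , k≤n , _ , _ , a₁+β<aₖ+b , aₖ+b≤K) (_ , _ , _ , _ , x+βb<y , _) =
    ordered-pairs-match
      (∸-monoʳ-< (≤-<-trans (m≤m+n _ β) a₁+β<aₖ+b) aₖ+b≤K)
      (≤-<-trans (m≤m+n _ βb) x+βb<y)
      (row-image aₖ+b≤K (F.junction-Φ-last k≤n))
      (row-image (≤-trans (m≤m+n _ β) (<⇒≤ (<-≤-trans a₁+β<aₖ+b aₖ+b≤K))) (F.junction-Φ K<n (1+n≢n ∘ sym)))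
    where
    K<n : K < n
    K<n = ≤-trans (n≤1+n (suc K)) k≤n

    row-image : ∀ {x} → x ≤ K → IsJunction (Φ (table (suc (suc K)) a b β)) (x , suc K) →
      K ∸ x ≡ at ab (suc K) ⊎ K ∸ x ≡ at ab (suc (suc K)) + bb
    row-image x≤K isJ =
      Sum.map₂ proj₂ (Fb.junction-Φ⁻¹ {suc (suc K)} (junction-ρ (dual _ (s≤s x≤K , K<n)) isJ))

  dual-nEnd : ∀ {K} →
    IsDual n (Φ (table (suc (suc K)) a b β)) (Φ (table (suc (suc K)) ab bb βb)) →
    at a (suc K) + β < K → suc K < n → K ∸ (at a (suc K) + β) ≡ suc (at ab (suc K) + βb)
  dual-nEnd {K} dual a₁+β<K k≤n = ,-injectiveˡ
    (Fb.nEnd-Φ⁻¹ (nEnd-ρ (dual _ (s≤s (m≤n⇒m≤1+n a₁+β<K) , k≤n)) (F.nEnd-Φ (≤-trans (n≤1+n (suc K)) k≤n))))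

  dual-penult : ∀ {K} →
    IsDual n (Φ (table (suc (suc K)) a b β)) (Φ (table (suc (suc K)) ab bb βb)) →
    ValidTable n (table (suc (suc K)) a b β) → ValidTable n (table (suc (suc K)) ab bb βb) →
      (at ab (suc K) ≡ K ∸ at a (suc (suc K)) ∸ b)
    × (bb ≡ at a (suc (suc K)) ∸ 1 ∸ at a (suc K))
    × (βb ≡ at a (suc (suc K)) + b ∸ at a (suc K) ∸ β ∸ 1)
  dual-penult {K} dual valid@(_ , k≤n , _ , a₁<aₖ , a₁+β<aₖ+b , aₖ+b≤K) validb =
    trans (sym x≡) (sym (∸-+-assoc K aₖ b)) , bb≡ , βb≡
    where
    a₁ aₖ : ℕ
    a₁ = at a (suc K)
    aₖ = at a (suc (suc K))

    x≡ : K ∸ (aₖ + b) ≡ at ab (suc K)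
    x≡ = proj₁ (dual-penult-row dual valid validb)

    aₖ≤1+K : aₖ ≤ suc K
    aₖ≤1+K = m≤n⇒m≤1+n (m+n≤o⇒m≤o aₖ aₖ+b≤K)

    abₖ+bb≡ : (suc K ∸ aₖ) + bb ≡ K ∸ a₁
    abₖ+bb≡ = trans (cong (_+ bb) (sym (proj₂ (dual-last-row {suc K} dual aₖ≤1+K k≤n))))
                   (sym (proj₂ (dual-penult-row dual valid validb)))

    bb≡ : bb ≡ aₖ ∸ 1 ∸ a₁
    bb≡ = trans ([m∸n]+o≡m∸p⇒o≡n∸p a₁<aₖ aₖ≤1+K abₖ+bb≡) (sym (∸-+-assoc aₖ 1 a₁))

    x+1+βb : (K ∸ (aₖ + b)) + suc βb ≡ K ∸ (a₁ + β)
    x+1+βb = begin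
      (K ∸ (aₖ + b)) + suc βb    ≡⟨ +-suc (K ∸ (aₖ + b)) βb ⟩
      suc (K ∸ (aₖ + b) + βb)    ≡⟨ cong (λ z → suc (z + βb)) x≡ ⟩
      suc (at ab (suc K) + βb)   ≡⟨ sym (dual-nEnd dual (<-≤-trans a₁+β<aₖ+b aₖ+b≤K) k≤n) ⟩
      K ∸ (a₁ + β)               ∎

    βb≡ : βb ≡ aₖ + b ∸ a₁ ∸ β ∸ 1
    βb≡ = cong (_∸ 1) (trans ([m∸n]+o≡m∸p⇒o≡n∸p (<⇒≤ a₁+β<aₖ+b) aₖ+b≤K x+1+βb)
                             (sym (∸-+-assoc (aₖ + b) a₁ β)))

mainTheorem10 : (n : ℕ) (Ω Ωb : Config n) (T Tb : Table n) →
    InM1 n Ω → InM1 n Ωb → IsDual n Ω Ωb →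
    ValidTable n T → ValidTable n Tb →
    (∀ j → Φ T j ≡ Ω j) → (∀ j → Φ Tb j ≡ Ωb j) →
    (Table.k Tb ≡ Table.k T)
    × (∀ (j : Fin n) → suc (toℕ j) ≢ Table.k T ∸ 1 → Table.a Tb j ≡ toℕ j ∸ Table.a T j)
    × (at (Table.a Tb) (Table.k T ∸ 1) ≡ Table.k T ∸ 2 ∸ at (Table.a T) (Table.k T) ∸ Table.b T)
    × (Table.b Tb ≡ at (Table.a T) (Table.k T) ∸ 1 ∸ at (Table.a T) (Table.k T ∸ 1))
    × (Table.β Tb ≡ at (Table.a T) (Table.k T) + Table.b T ∸ at (Table.a T) (Table.k T ∸ 1) ∸ Table.β T ∸ 1)
mainTheorem10 n Ω Ωb (table (suc (suc (suc m))) a b β) (table kb ab bb βb) _ _ dual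
              valid@(s≤s (s≤s (s≤s _)) , k≤n , a≤ , _ , _ , aₖ+b≤k-2) validb ΦT≡Ω ΦTb≡Ωb
  with dual-last-row {r = suc (suc m)} {kb = kb} (IsDual-resp ΦT≡Ω ΦTb≡Ωb dual) (m≤n⇒m≤1+n (m+n≤o⇒m≤o _ aₖ+b≤k-2)) k≤n
... | refl , _ = refl , dual-entries {k = suc (suc (suc m))} dual′ a≤ , dual-penult dual′ valid validb
  where
  dual′ : IsDual n (Φ (table (suc (suc (suc m))) a b β)) (Φ (table (suc (suc (suc m))) ab bb βb))
  dual′ = IsDual-resp ΦT≡Ω ΦTb≡Ωb dual
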